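{- For all $\lambda$-terms: (1) Persistence: if $t\to_w s$ and $t\to_{\neg w}u$ then $u\to_w r$ for some $r$. (2) Diamond: if $t\to_w s$ and $t\to_w u$ with $s\neq u$, then there is $r$ with $s\to_w r$ and $u\to_w r$. Consequently $(\Lambda,\{\to_w,\to_{\neg w}\})$ is an essential system.
   Context: $\Lambda$ is the set of $\lambda$-terms $t::=x\mid\lambda x.t\mid ts$ (up to $\alpha$-equivalence); values $v::=x\mid\lambda x.t$; $t\{x:=s\}$ capture-avoiding substitution. $\to_{\beta_v}$: closure of $(\lambda x.t)v\to_{\beta_v}t\{x:=v\}$ ($v$ a value) under abstraction and both sides of application. $\to_w$: $(\lambda x.t)v\to_w t\{x:=v\}$ ($v$ value); if $t\to_w t'$ then $ts\to_w t's$ and $st\to_w st'$. $\to_{\neg w}$: if $t\to_{\beta_v}s$ then $\lambda x.t\to_{\neg w}\lambda x.s$; if $t\to_{\neg w}t'$ then $ts\to_{\neg w}t's$ and $st\to_{\neg w}st'$. A system $(S,\{\to_e,\to_{\neg e}\})$ with $\to=\to_e\cup\to_{\neg e}$ is essential if: (persistence) $t\to_e s$ and $t\to_{\neg e}u$ imply $u\to_e r$ for some $r$; (uniform termination) every term that $\to_e^*$-reduces to a $\to_e$-normal term has no infinite $\to_e$-sequence; (terminal factorization) if $t\to^*u$ with $u$ $\to_e$-normal then $t\to_e^*\cdot\to_{\neg e}^*u$. -}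

module Defs where

open import Data.Nat using (ℕ; zero; suc)
open import Data.Product using (Σ; ∃; _×_; _,_)
open import Data.Sum using (_⊎_)
open import Relation.Nullary using (¬_)
open import Relation.Binary.PropositionalEquality using (_≡_; _≢_)
open import Relation.Binary.Construct.Closure.ReflexiveTransitive using (Star)

-- λ-terms up to α-equivalence: de Bruijn indices (var 0 = innermost binder)

infixl 7 _·_
data Term : Set where
  var : ℕ → Term
  ƛ_  : Term → Term
  _·_ : Term → Term → Term

ext : (ℕ → ℕ) → ℕ → ℕ
ext ρ zero    = zero
ext ρ (suc n) = suc (ρ n)

rename : (ℕ → ℕ) → Term → Term
rename ρ (var x) = var (ρ x)
rename ρ (ƛ t)   = ƛ rename (ext ρ) t
rename ρ (t · s) = rename ρ t · rename ρ s

exts : (ℕ → Term) → ℕ → Term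
exts σ zero    = var zero
exts σ (suc n) = rename suc (σ n)

subst : (ℕ → Term) → Term → Term
subst σ (var x) = σ x
subst σ (ƛ t)   = ƛ subst (exts σ) t
subst σ (t · s) = subst σ t · subst σ s

subst-zero : Term → ℕ → Term
subst-zero s zero    = s
subst-zero s (suc n) = var n

_[_] : Term → Term → Term
t [ s ] = subst (subst-zero s) t

data Value : Term → Set where
  V-var : ∀ {x} → Value (var x)
  V-ƛ   : ∀ {t} → Value (ƛ t)

infix 4 _→βv_ _→w_ _→¬w_ _⟶_

data _→βv_ : Term → Term → Set where
  βv   : ∀ {t v} → Value v → (ƛ t) · v →βv t [ v ]
  ξƛ   : ∀ {t t'} → t →βv t' → ƛ t →βv ƛ t'
  ξ·l  : ∀ {t t' s} → t →βv t' → t · s →βv t' · s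
  ξ·r  : ∀ {t t' s} → t →βv t' → s · t →βv s · t'

data _→w_ : Term → Term → Set where
  βv   : ∀ {t v} → Value v → (ƛ t) · v →w t [ v ]
  ξ·l  : ∀ {t t' s} → t →w t' → t · s →w t' · s
  ξ·r  : ∀ {t t' s} → t →w t' → s · t →w s · t'

data _→¬w_ : Term → Term → Set where
  ξƛ   : ∀ {t s} → t →βv s → ƛ t →¬w ƛ s
  ξ·l  : ∀ {t t' s} → t →¬w t' → t · s →¬w t' · s
  ξ·r  : ∀ {t t' s} → t →¬w t' → s · t →¬w s · t'

_⟶_ : Term → Term → Set
t ⟶ s = (t →w s) ⊎ (t →¬w s)

module _ {S : Set} (_→e_ : S → S → Set) where

  Normal : S → Set
  Normal t = ¬ (∃ λ s → t →e s)

  NoInfiniteSeq : S → Set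
  NoInfiniteSeq t = ¬ (Σ (ℕ → S) λ f → (f zero ≡ t) × (∀ n → f n →e f (suc n)))

  UniformTermination : Set
  UniformTermination =
    ∀ t → (∃ λ u → Star _→e_ t u × Normal u) → NoInfiniteSeq t

module _ {S : Set} (_→e_ _→¬e_ : S → S → Set) where

  Persistence : Set
  Persistence = ∀ {t s u} → t →e s → t →¬e u → ∃ λ r → u →e r

  TerminalFactorization : Set
  TerminalFactorization =
    ∀ {t u} → Star (λ a b → (a →e b) ⊎ (a →¬e b)) t u → Normal _→e_ u →
      ∃ λ m → Star _→e_ t m × Star _→¬e_ m u

  record Essential : Set where
    field
      persistence         : Persistence
      uniformTermination  : UniformTermination _→e_
      terminalFactorization : TerminalFactorization

Diamond : {S : Set} → (S → S → Set) → Set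
Diamond _→e_ = ∀ {t s u} → t →e s → t →e u → s ≢ u → ∃ λ r → (s →e r) × (u →e r)

module Submission where

-- Abstract rewriting, for an arbitrary relation →e:
--  * a QUASI-DIAMOND (two one-step reducts are equal or one-step joinable)
--    yields the diamond property and uniform termination: every reduction
--    path to a normal form has the same length, so no infinite path exists;
--  * if the internal steps →i embed into a relation ⇛ ⊆ →i* that can be
--    pushed behind an →e-step (⇛ ; →e ⊆ →e* ; ⇛), then every mixed
--    reduction factorizes as →e* ; →i*.
--
-- The λ-calculus: after the usual substitution algebra we introduce
-- parallel βv-reduction ⇒ and its "internal" restriction ⇛ (no contraction
-- of weak redexes) and prove Takahashi-style splitting ⇒ ⊆ →w* ; ⇛ and
-- merging ⇛ ; →w ⊆ →w ; ⇒, which give the hypothesis of the factorization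
-- lemma.

open import Defs
open import Data.Nat using (ℕ; zero; suc)
open import Data.Product using (_×_; _,_; ∃)
open import Data.Sum using (_⊎_; inj₁; inj₂)
open import Data.Empty using (⊥; ⊥-elim)
open import Relation.Binary.PropositionalEquality
  using (_≡_; refl; sym; trans; cong; cong₂) renaming (subst to transport)
open import Relation.Binary.Construct.Closure.ReflexiveTransitive
  using (Star; ε; _◅_; _◅◅_; gmap)

module QuasiDiamondTheory {S : Set} (_→e_ : S → S → Set) where

  QuasiDiamond : Set
  QuasiDiamond = ∀ {t s u} → t →e s → t →e u →
                 (s ≡ u) ⊎ (∃ λ r → (s →e r) × (u →e r))

  quasiDiamond⇒diamond : QuasiDiamond → Diamond _→e_
  quasiDiamond⇒diamond qd ts tu s≢u with qd ts tu
  ... | inj₁ s≡u   = ⊥-elim (s≢u s≡u)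
  ... | inj₂ join = join

  -- Reduction paths of a given length; the length is the termination measure.
  data _⟶⟨_⟩_ : S → ℕ → S → Set where
    done : ∀ {t} → t ⟶⟨ zero ⟩ t
    step : ∀ {n t s u} → t →e s → s ⟶⟨ n ⟩ u → t ⟶⟨ suc n ⟩ u

  star⇒path : ∀ {t u} → Star _→e_ t u → ∃ λ n → t ⟶⟨ n ⟩ u
  star⇒path ε         = zero , done
  star⇒path (r ◅ rs) with star⇒path rs
  ... | n , p = suc n , step r p

  module _ (qd : QuasiDiamond) where

    -- Random descent: along any first step t →e s, the normal form u is
    -- still reached, by a path exactly one step shorter.
    descend : ∀ {n t s u} → t ⟶⟨ suc n ⟩ u → Normal _→e_ u →
              t →e s → s ⟶⟨ n ⟩ u
    descend (step ts′ rest) nf ts with qd ts′ ts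
    ... | inj₁ refl = rest
    descend {zero}  (step ts′ done) nf ts | inj₂ (r , s′r , _) =
      ⊥-elim (nf (r , s′r))
    descend {suc n} (step ts′ rest) nf ts | inj₂ (r , s′r , sr) =
      step sr (descend rest nf s′r)

    path⇒noInfiniteSeq : ∀ n {t u} → t ⟶⟨ n ⟩ u → Normal _→e_ u →
                         NoInfiniteSeq _→e_ t
    path⇒noInfiniteSeq zero    done nf (f , refl , inc) = nf (f 1 , inc 0)
    path⇒noInfiniteSeq (suc n) p    nf (f , refl , inc) =
      path⇒noInfiniteSeq n (descend p nf (inc 0)) nf
        ((λ k → f (suc k)) , refl , (λ k → inc (suc k)))

    quasiDiamond⇒uniformTermination : UniformTermination _→e_
    quasiDiamond⇒uniformTermination t (u , tu , nf) with star⇒path tu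
    ... | n , p = path⇒noInfiniteSeq n p nf

module Postponement
  {S : Set} (_→e_ _→i_ _⇛_ : S → S → Set)
  (i⊆⇛  : ∀ {t s} → t →i s → t ⇛ s)
  (⇛⊆i* : ∀ {t s} → t ⇛ s → Star _→i_ t s)
  (swap : ∀ {t s u} → t ⇛ s → s →e u → ∃ λ m → Star _→e_ t m × m ⇛ u)
  where

  postpone : ∀ {t s u} → t ⇛ s → Star _→e_ s u →
             ∃ λ m → Star _→e_ t m × m ⇛ u
  postpone {t} ts ε = t , ε , ts
  postpone ts (su ◅ rest) with swap ts su
  ... | m , tm , m⇛ with postpone m⇛ rest
  ... | m′ , mm′ , m′⇛ = m′ , tm ◅◅ mm′ , m′⇛

  -- Every mixed reduction factorizes.
  factorization : ∀ {t u} → Star (λ a b → (a →e b) ⊎ (a →i b)) t u →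
                  ∃ λ m → Star _→e_ t m × Star _→i_ m u
  factorization {t} ε = t , ε , ε
  factorization (inj₁ ts ◅ rest) with factorization rest
  ... | m , sm , mu = m , ts ◅ sm , mu
  factorization (inj₂ ts ◅ rest) with factorization rest
  ... | m , sm , mu with postpone (i⊆⇛ ts) sm
  ... | m′ , tm′ , m′m = m′ , tm′ , ⇛⊆i* m′m ◅◅ mu

  terminalFactorization : TerminalFactorization _→e_ _→i_
  terminalFactorization tu _ = factorization tu

-- De Bruijn renamings and substitutions; rename/subst respect pointwise
-- equality, which lets the fusion laws be proved under binders.
Renaming Substitution : Set
Renaming     = ℕ → ℕ
Substitution = ℕ → Term

rename-cong : ∀ {ρ ρ′ : Renaming} → (∀ x → ρ x ≡ ρ′ x) →
              ∀ t → rename ρ t ≡ rename ρ′ t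
rename-cong h (var x) = cong var (h x)
rename-cong {ρ} {ρ′} h (ƛ t) = cong ƛ_ (rename-cong ext-h t)
  where
  ext-h : ∀ x → ext ρ x ≡ ext ρ′ x
  ext-h zero    = refl
  ext-h (suc x) = cong suc (h x)
rename-cong h (t · s) = cong₂ _·_ (rename-cong h t) (rename-cong h s)

subst-cong : ∀ {σ σ′ : Substitution} → (∀ x → σ x ≡ σ′ x) →
             ∀ t → subst σ t ≡ subst σ′ t
subst-cong h (var x) = h x
subst-cong {σ} {σ′} h (ƛ t) = cong ƛ_ (subst-cong exts-h t)
  where
  exts-h : ∀ x → exts σ x ≡ exts σ′ x
  exts-h zero    = refl
  exts-h (suc x) = cong (rename suc) (h x)
subst-cong h (t · s) = cong₂ _·_ (subst-cong h t) (subst-cong h s)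

rename-rename : ∀ ρ ρ′ t → rename ρ (rename ρ′ t) ≡ rename (λ x → ρ (ρ′ x)) t
rename-rename ρ ρ′ (var x) = refl
rename-rename ρ ρ′ (ƛ t)   =
  cong ƛ_ (trans (rename-rename (ext ρ) (ext ρ′) t) (rename-cong ext-fuse t))
  where
  ext-fuse : ∀ x → ext ρ (ext ρ′ x) ≡ ext (λ y → ρ (ρ′ y)) x
  ext-fuse zero    = refl
  ext-fuse (suc x) = refl
rename-rename ρ ρ′ (t · s) = cong₂ _·_ (rename-rename ρ ρ′ t) (rename-rename ρ ρ′ s)

subst-rename : ∀ σ ρ t → subst σ (rename ρ t) ≡ subst (λ x → σ (ρ x)) t
subst-rename σ ρ (var x) = refl
subst-rename σ ρ (ƛ t)   =
  cong ƛ_ (trans (subst-rename (exts σ) (ext ρ) t) (subst-cong exts-fuse t))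
  where
  exts-fuse : ∀ x → exts σ (ext ρ x) ≡ exts (λ y → σ (ρ y)) x
  exts-fuse zero    = refl
  exts-fuse (suc x) = refl
subst-rename σ ρ (t · s) = cong₂ _·_ (subst-rename σ ρ t) (subst-rename σ ρ s)

rename-subst : ∀ ρ σ t → rename ρ (subst σ t) ≡ subst (λ x → rename ρ (σ x)) t
rename-subst ρ σ (var x) = refl
rename-subst ρ σ (ƛ t)   =
  cong ƛ_ (trans (rename-subst (ext ρ) (exts σ) t) (subst-cong exts-fuse t))
  where
  exts-fuse : ∀ x → rename (ext ρ) (exts σ x) ≡ exts (λ y → rename ρ (σ y)) x
  exts-fuse zero    = refl
  exts-fuse (suc x) =
    trans (rename-rename (ext ρ) suc (σ x)) (sym (rename-rename suc ρ (σ x)))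
rename-subst ρ σ (t · s) = cong₂ _·_ (rename-subst ρ σ t) (rename-subst ρ σ s)

subst-subst : ∀ τ σ t → subst τ (subst σ t) ≡ subst (λ x → subst τ (σ x)) t
subst-subst τ σ (var x) = refl
subst-subst τ σ (ƛ t)   =
  cong ƛ_ (trans (subst-subst (exts τ) (exts σ) t) (subst-cong exts-fuse t))
  where
  exts-fuse : ∀ x → subst (exts τ) (exts σ x) ≡ exts (λ y → subst τ (σ y)) x
  exts-fuse zero    = refl
  exts-fuse (suc x) =
    trans (subst-rename (exts τ) suc (σ x)) (sym (rename-subst suc τ (σ x)))
subst-subst τ σ (t · s) = cong₂ _·_ (subst-subst τ σ t) (subst-subst τ σ s)

subst-var : ∀ t → subst var t ≡ t
subst-var (var x) = refl
subst-var (ƛ t)   = cong ƛ_ (trans (subst-cong exts-var t) (subst-var t))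
  where
  exts-var : ∀ x → exts var x ≡ var x
  exts-var zero    = refl
  exts-var (suc x) = refl
subst-var (t · s) = cong₂ _·_ (subst-var t) (subst-var s)

rename-[] : ∀ ρ b w → rename ρ (b [ w ]) ≡ rename (ext ρ) b [ rename ρ w ]
rename-[] ρ b w =
  trans (rename-subst ρ (subst-zero w) b)
    (trans (subst-cong commute b)
           (sym (subst-rename (subst-zero (rename ρ w)) (ext ρ) b)))
  where
  commute : ∀ x → rename ρ (subst-zero w x) ≡ subst-zero (rename ρ w) (ext ρ x)
  commute zero    = refl
  commute (suc x) = refl

subst-[] : ∀ σ b w → subst σ (b [ w ]) ≡ subst (exts σ) b [ subst σ w ]
subst-[] σ b w =
  trans (subst-subst σ (subst-zero w) b)
    (trans (subst-cong commute b)
           (sym (subst-subst (subst-zero (subst σ w)) (exts σ) b)))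
  where
  commute : ∀ x → subst σ (subst-zero w x) ≡ subst (subst-zero (subst σ w)) (exts σ x)
  commute zero    = refl
  commute (suc x) =
    sym (trans (subst-rename (subst-zero (subst σ w)) suc (σ x)) (subst-var (σ x)))

ValueSubst : Substitution → Set
ValueSubst σ = ∀ x → Value (σ x)

rename-value : ∀ ρ {v} → Value v → Value (rename ρ v)
rename-value ρ V-var = V-var
rename-value ρ V-ƛ   = V-ƛ

exts-value : ∀ {σ} → ValueSubst σ → ValueSubst (exts σ)
exts-value vσ zero    = V-var
exts-value vσ (suc x) = rename-value suc (vσ x)

subst-zero-value : ∀ {v} → Value v → ValueSubst (subst-zero v)
subst-zero-value V zero    = V
subst-zero-value V (suc x) = V-var

subst-value : ∀ {σ v} → ValueSubst σ → Value v → Value (subst σ v)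
subst-value vσ (V-var {x}) = vσ x
subst-value vσ V-ƛ         = V-ƛ

-- Weak reduction is stable under substitution of values (βv-redexes are
-- preserved because values are).
→w-subst : ∀ {σ t t′} → ValueSubst σ → t →w t′ → subst σ t →w subst σ t′
→w-subst {σ} vσ (βv {t = b} {v = v} V) =
  transport (subst σ ((ƛ b) · v) →w_) (sym (subst-[] σ b v)) (βv (subst-value vσ V))
→w-subst vσ (ξ·l r) = ξ·l (→w-subst vσ r)
→w-subst vσ (ξ·r r) = ξ·r (→w-subst vσ r)

infix 4 _⇒_ _⇛_

data _⇒_ : Term → Term → Set where
  pvar : ∀ {x} → var x ⇒ var x
  pƛ   : ∀ {t t′} → t ⇒ t′ → ƛ t ⇒ ƛ t′
  p·   : ∀ {t t′ s s′} → t ⇒ t′ → s ⇒ s′ → t · s ⇒ t′ · s′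
  pβ   : ∀ {b b′ v v′} → Value v → b ⇒ b′ → v ⇒ v′ → (ƛ b) · v ⇒ b′ [ v′ ]

-- ⇛ reduces in parallel only below λ, i.e. it never fires a weak redex.
data _⇛_ : Term → Term → Set where
  ivar : ∀ {x} → var x ⇛ var x
  iƛ   : ∀ {t t′} → t ⇒ t′ → ƛ t ⇛ ƛ t′
  i·   : ∀ {t t′ s s′} → t ⇛ t′ → s ⇛ s′ → t · s ⇛ t′ · s′

⇒-refl : ∀ t → t ⇒ t
⇒-refl (var x) = pvar
⇒-refl (ƛ t)   = pƛ (⇒-refl t)
⇒-refl (t · s) = p· (⇒-refl t) (⇒-refl s)

⇛-refl : ∀ t → t ⇛ t
⇛-refl (var x) = ivar
⇛-refl (ƛ t)   = iƛ (⇒-refl t)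
⇛-refl (t · s) = i· (⇛-refl t) (⇛-refl s)

⇛⊆⇒ : ∀ {t s} → t ⇛ s → t ⇒ s
⇛⊆⇒ ivar     = pvar
⇛⊆⇒ (iƛ r)   = pƛ r
⇛⊆⇒ (i· r q) = p· (⇛⊆⇒ r) (⇛⊆⇒ q)

⇒-value : ∀ {v v′} → Value v → v ⇒ v′ → Value v′
⇒-value V-var pvar   = V-var
⇒-value V-ƛ   (pƛ _) = V-ƛ

value-⇒⊆⇛ : ∀ {v v′} → Value v → v ⇒ v′ → v ⇛ v′
value-⇒⊆⇛ V-var pvar   = ivar
value-⇒⊆⇛ V-ƛ   (pƛ r) = iƛ r

⇛-reflects-value : ∀ {v v′} → Value v′ → v ⇛ v′ → Value v
⇛-reflects-value V-var ivar   = V-var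
⇛-reflects-value V-ƛ   (iƛ _) = V-ƛ

⇒-rename : ∀ ρ {t t′} → t ⇒ t′ → rename ρ t ⇒ rename ρ t′
⇒-rename ρ pvar     = pvar
⇒-rename ρ (pƛ r)   = pƛ (⇒-rename (ext ρ) r)
⇒-rename ρ (p· r q) = p· (⇒-rename ρ r) (⇒-rename ρ q)
⇒-rename ρ (pβ {b′ = b′} {v′ = v′} V r q) =
  transport (_ ⇒_) (sym (rename-[] ρ b′ v′))
    (pβ (rename-value ρ V) (⇒-rename (ext ρ) r) (⇒-rename ρ q))

_⇒ˢ_ : Substitution → Substitution → Set
σ ⇒ˢ σ′ = ∀ x → σ x ⇒ σ′ x

exts-⇒ˢ : ∀ {σ σ′} → σ ⇒ˢ σ′ → exts σ ⇒ˢ exts σ′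
exts-⇒ˢ rσ zero    = pvar
exts-⇒ˢ rσ (suc x) = ⇒-rename suc (rσ x)

⇒-subst : ∀ {σ σ′ t t′} → ValueSubst σ → σ ⇒ˢ σ′ → t ⇒ t′ →
          subst σ t ⇒ subst σ′ t′
⇒-subst vσ rσ (pvar {x}) = rσ x
⇒-subst vσ rσ (pƛ r)     = pƛ (⇒-subst (exts-value vσ) (exts-⇒ˢ rσ) r)
⇒-subst vσ rσ (p· r q)   = p· (⇒-subst vσ rσ r) (⇒-subst vσ rσ q)
⇒-subst {σ′ = σ′} vσ rσ (pβ {b′ = b′} {v′ = v′} V r q) =
  transport (_ ⇒_) (sym (subst-[] σ′ b′ v′))
    (pβ (subst-value vσ V) (⇒-subst (exts-value vσ) (exts-⇒ˢ rσ) r) (⇒-subst vσ rσ q))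

subst-zero-⇒ˢ : ∀ {v v′} → v ⇒ v′ → subst-zero v ⇒ˢ subst-zero v′
subst-zero-⇒ˢ r zero    = r
subst-zero-⇒ˢ r (suc x) = pvar

⇛-subst : ∀ {σ σ′ t t′} → ValueSubst σ → (∀ x → σ x ⇛ σ′ x) → t ⇛ t′ →
          subst σ t ⇛ subst σ′ t′
⇛-subst vσ rσ (ivar {x}) = rσ x
⇛-subst vσ rσ (iƛ r)     = iƛ (⇒-subst (exts-value vσ) (exts-⇒ˢ (λ x → ⇛⊆⇒ (rσ x))) r)
⇛-subst vσ rσ (i· r q)   = i· (⇛-subst vσ rσ r) (⇛-subst vσ rσ q)

⇛-[] : ∀ {t t′ v v′} → Value v → t ⇛ t′ → v ⇛ v′ → t [ v ] ⇛ t′ [ v′ ]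
⇛-[] {v = v} {v′} V r rv = ⇛-subst (subst-zero-value V) subst-zero-⇛ r
  where
  subst-zero-⇛ : ∀ x → subst-zero v x ⇛ subst-zero v′ x
  subst-zero-⇛ zero    = rv
  subst-zero-⇛ (suc x) = ivar

-- Takahashi splitting: a parallel step first fires its weak redexes, then
-- performs the remaining (internal) work in parallel.
split : ∀ {t s} → t ⇒ s → ∃ λ m → Star _→w_ t m × m ⇛ s
split (pvar {x})   = var x , ε , ivar
split (pƛ {t} r)   = ƛ t , ε , iƛ r
split (p· {s = s} r q) with split r | split q
... | m₁ , w₁ , i₁ | m₂ , w₂ , i₂ =
  m₁ · m₂ , gmap (_· s) ξ·l w₁ ◅◅ gmap (m₁ ·_) ξ·r w₂ , i· i₁ i₂
split (pβ {v = v} V r q) with split r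
... | m , w , i =
  m [ v ] ,
  βv V ◅ gmap (_[ v ]) (→w-subst (subst-zero-value V)) w ,
  ⇛-[] V i (value-⇒⊆⇛ V q)

merge : ∀ {t s u} → t ⇛ s → s →w u → ∃ λ m → (t →w m) × (m ⇒ u)
merge (i· (iƛ r) q) (βv V) =
  let V′ = ⇛-reflects-value V q in
  _ , βv V′ , ⇒-subst (subst-zero-value V′) (subst-zero-⇒ˢ (⇛⊆⇒ q)) r
merge (i· r q) (ξ·l w) with merge r w
... | _ , w′ , r′ = _ , ξ·l w′ , p· r′ (⇛⊆⇒ q)
merge (i· r q) (ξ·r w) with merge q w
... | _ , w′ , q′ = _ , ξ·r w′ , p· (⇛⊆⇒ r) q′

⇛-swap-→w : ∀ {t s u} → t ⇛ s → s →w u → ∃ λ m → Star _→w_ t m × m ⇛ u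
⇛-swap-→w ts su with merge ts su
... | m , tm , mu with split mu
... | m′ , mm′ , m′u = m′ , tm ◅ mm′ , m′u

βv⊆⇒ : ∀ {t s} → t →βv s → t ⇒ s
βv⊆⇒ (βv V)   = pβ V (⇒-refl _) (⇒-refl _)
βv⊆⇒ (ξƛ r)   = pƛ (βv⊆⇒ r)
βv⊆⇒ (ξ·l r)  = p· (βv⊆⇒ r) (⇒-refl _)
βv⊆⇒ (ξ·r r)  = p· (⇒-refl _) (βv⊆⇒ r)

¬w⊆⇛ : ∀ {t s} → t →¬w s → t ⇛ s
¬w⊆⇛ (ξƛ r)  = iƛ (βv⊆⇒ r)
¬w⊆⇛ (ξ·l r) = i· (¬w⊆⇛ r) (⇛-refl _)
¬w⊆⇛ (ξ·r r) = i· (⇛-refl _) (¬w⊆⇛ r)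

⇒⊆βv* : ∀ {t s} → t ⇒ s → Star _→βv_ t s
⇒⊆βv* pvar = ε
⇒⊆βv* (pƛ r) = gmap ƛ_ ξƛ (⇒⊆βv* r)
⇒⊆βv* (p· {t′ = t′} {s = s} r q) =
  gmap (_· s) ξ·l (⇒⊆βv* r) ◅◅ gmap (t′ ·_) ξ·r (⇒⊆βv* q)
⇒⊆βv* (pβ {b′ = b′} {v = v} V r q) =
  gmap (λ b → (ƛ b) · v) (λ rb → ξ·l (ξƛ rb)) (⇒⊆βv* r) ◅◅
  gmap ((ƛ b′) ·_) ξ·r (⇒⊆βv* q) ◅◅
  βv (⇒-value V q) ◅ ε

⇛⊆¬w* : ∀ {t s} → t ⇛ s → Star _→¬w_ t s
⇛⊆¬w* ivar = ε
⇛⊆¬w* (iƛ r) = gmap ƛ_ ξƛ (⇒⊆βv* r)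
⇛⊆¬w* (i· {t′ = t′} {s = s} r q) =
  gmap (_· s) ξ·l (⇛⊆¬w* r) ◅◅ gmap (t′ ·_) ξ·r (⇛⊆¬w* q)

-- A non-weak step (under a λ) never destroys a weak redex.
→w-persistence : Persistence _→w_ _→¬w_
→w-persistence (βv V)       (ξ·l (ξƛ _)) = _ , βv V
→w-persistence (βv V-ƛ)     (ξ·r (ξƛ _)) = _ , βv V-ƛ
→w-persistence (ξ·l w)      (ξ·l n) with →w-persistence w n
... | _ , w′ = _ , ξ·l w′
→w-persistence (ξ·l w)      (ξ·r _) = _ , ξ·l w
→w-persistence (ξ·r w)      (ξ·l _) = _ , ξ·r w
→w-persistence (ξ·r w)      (ξ·r n) with →w-persistence w n
... | _ , w′ = _ , ξ·r w′

-- Weak reduction never enters a λ, so values are →w-normal.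
value-→w-normal : ∀ {v s} → Value v → v →w s → ⊥
value-→w-normal V-var ()
value-→w-normal V-ƛ   ()

-- Weak redexes do not overlap: a βv-redex has no weak step inside it.
→w-quasiDiamond : QuasiDiamondTheory.QuasiDiamond _→w_
→w-quasiDiamond (βv _)  (βv _)  = inj₁ refl
→w-quasiDiamond (βv _)  (ξ·l ())
→w-quasiDiamond (βv V)  (ξ·r w) = ⊥-elim (value-→w-normal V w)
→w-quasiDiamond (ξ·l ()) (βv _)
→w-quasiDiamond (ξ·r w) (βv V)  = ⊥-elim (value-→w-normal V w)
→w-quasiDiamond (ξ·l w₁) (ξ·l w₂) with →w-quasiDiamond w₁ w₂
... | inj₁ eq            = inj₁ (cong (_· _) eq)
... | inj₂ (_ , r₁ , r₂) = inj₂ (_ , ξ·l r₁ , ξ·l r₂)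
→w-quasiDiamond (ξ·l w₁) (ξ·r w₂) = inj₂ (_ , ξ·r w₂ , ξ·l w₁)
→w-quasiDiamond (ξ·r w₁) (ξ·l w₂) = inj₂ (_ , ξ·l w₂ , ξ·r w₁)
→w-quasiDiamond (ξ·r w₁) (ξ·r w₂) with →w-quasiDiamond w₁ w₂
... | inj₁ eq            = inj₁ (cong (_ ·_) eq)
... | inj₂ (_ , r₁ , r₂) = inj₂ (_ , ξ·r r₁ , ξ·r r₂)

proposition5 : Persistence _→w_ _→¬w_ × Diamond _→w_ × Essential _→w_ _→¬w_
proposition5 =
  →w-persistence ,
  quasiDiamond⇒diamond →w-quasiDiamond ,
  record
    { persistence           = →w-persistence
    ; uniformTermination    = quasiDiamond⇒uniformTermination →w-quasiDiamond
    ; terminalFactorization =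
        Postponement.terminalFactorization _→w_ _→¬w_ _⇛_ ¬w⊆⇛ ⇛⊆¬w* ⇛-swap-→w
    }
  where open QuasiDiamondTheory _→w_
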